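{- Let $p\geq1$ and let $(a_n)_{n\in\mathbb{Z}}$ be a bi-infinite sequence of complex numbers. With the collections of paths and formal series defined in the context, the following identities hold in $\mathbb{C}((z^{ -1}))$: \[ R_{0}(z)=\frac{1}{z-\sum_{\ell=0}^{p}a_{ -\ell}\,S_{p-\ell-1}^{(1)}(z)\,T_{\ell-1}^{(1)}(z)}, \] where $S^{(1)}_{ -1}(z)\equiv T_{ -1}^{(1)}(z)\equiv 1$; \[ R_{j}(z)=R_{0}(z)\,S_{j-1}^{(1)}(z)\quad(1\leq j\leq p); \] and more generally $R_{j}(z)=R_{i}(z)\,S_{j-i-1}^{(i+1)}(z)$ for $0\leq i<j\leq p$.
   Context: $\mathbb{C}((z^{ -1}))$ denotes the field of formal series $\sum_{n\in\mathbb{Z}} c_n z^{ -n}$ with only finitely many nonzero $c_n$, $n<0$. Consider lattice paths with vertices in $\mathbb{Z}_{\geq0}\times\mathbb{Z}$, given as finite sequences of steps (consecutive steps sharing endpoints), with only two kinds of steps: upsteps $(n,m)\to(n+1,m+1)$, of weight $1$, and downsteps $(n,m)\to(n+1,m-p)$, of weight $a_{m-p}$. The length of a path is its number of steps; its weight $w(\gamma)$ is the product of its step weights ($1$ for length $0$). For an integer $q$, $\gamma+q$ is the vertical shift of $\gamma$ by $q$. $\min(\gamma)$, $\max(\gamma)$ are the minimal and maximal heights of its vertices. For $n\geq0$, $0\leq j\leq p$: $\mathcal{R}_{[n,j]}$ is the set of such paths of length $n$ from $(0,0)$ to $(n,j)$; $\mathcal{S}_{[n,j]}=\{\gamma\in\mathcal{R}_{[n,j]}:\min(\gamma)=0\}$;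 $\widehat{\mathcal{S}}_{[n,j]}$ is the set of such paths of length $n$ from $(0,-j)$ to $(n,0)$ with $\max(\gamma)=0$. For integers $q\geq0$ define $R_{[n,j]}=\sum_{\gamma\in\mathcal{R}_{[n,j]}}w(\gamma)$, $S^{(q)}_{[n,j]}=\sum_{\gamma\in\mathcal{S}_{[n,j]}}w(\gamma+q)$, $T^{(q)}_{[n,j]}=\sum_{\gamma\in\widehat{\mathcal{S}}_{[n,j]}}w(\gamma-q)$ (empty sums are $0$), and the formal series $R_j(z)=\sum_{n\ge0}R_{[n,j]}z^{ -n-1}$, $S^{(q)}_j(z)=\sum_{n\ge0}S^{(q)}_{[n,j]}z^{ -n-1}$, $T^{(q)}_j(z)=\sum_{n\ge0}T^{(q)}_{[n,j]}z^{ -n-1}$. -}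

module Defs where

open import Algebra.Bundles using (CommutativeRing)
open import Data.Nat as ℕ using (ℕ; zero; suc; _∸_)
open import Data.Integer as ℤ using (ℤ; +_; -[1+_]; _⊓_; _⊔_)
open import Data.Bool using (Bool; true; false; if_then_else_; _∧_)
open import Data.List using (List; []; _∷_; map; _++_; foldr; upTo)
open import Data.Vec using (Vec; []; _∷_)
open import Relation.Nullary.Decidable using (⌊_⌋)

-- all step sequences of length n (true = upstep, false = downstep)
allVec : (n : ℕ) → List (Vec Bool n)
allVec zero    = [] ∷ []
allVec (suc n) = map (true ∷_) (allVec n) ++ map (false ∷_) (allVec n)

module Paths {c ℓ} (R : CommutativeRing c ℓ) (p : ℕ)
             (a : ℤ → CommutativeRing.Carrier R) where
  open CommutativeRing R renaming (Carrier to C)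

  -- Lattice paths: a path is a start height together with a step sequence.

  next : ℤ → Bool → ℤ
  next m true  = m ℤ.+ + 1
  next m false = m ℤ.- + p

  stepW : ℤ → Bool → C
  stepW m true  = 1#
  stepW m false = a (m ℤ.- + p)

  weight : ∀ {n} → ℤ → Vec Bool n → C
  weight m []      = 1#
  weight m (b ∷ s) = stepW m b * weight (next m b) s

  endH : ∀ {n} → ℤ → Vec Bool n → ℤ
  endH m []      = m
  endH m (b ∷ s) = endH (next m b) s

  minH : ∀ {n} → ℤ → Vec Bool n → ℤ
  minH m []      = m
  minH m (b ∷ s) = m ⊓ minH (next m b) s

  maxH : ∀ {n} → ℤ → Vec Bool n → ℤ
  maxH m []      = m
  maxH m (b ∷ s) = m ⊔ maxH (next m b) s

  sumL : List C → C
  sumL = foldr _+_ 0#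

  infix 4 _==_
  _==_ : ℤ → ℤ → Bool
  x == y = ⌊ x ℤ.≟ y ⌋

  Rc : (n j : ℕ) → C
  Rc n j = sumL (map (λ s → if (endH (+ 0) s == + j) then weight (+ 0) s else 0#)
                     (allVec n))

  Sc : (q n j : ℕ) → C
  Sc q n j = sumL (map (λ s → if (endH (+ 0) s == + j) ∧ (minH (+ 0) s == + 0)
                               then weight (+ q) s else 0#)
                       (allVec n))

  Tc : (q n j : ℕ) → C
  Tc q n j = sumL (map (λ s → if (endH (ℤ.- + j) s == + 0) ∧ (maxH (ℤ.- + j) s == + 0)
                               then weight (ℤ.- + j ℤ.- + q) s else 0#)
                       (allVec n))

  -- Formal Laurent series in z^{-1}:  lau k f  represents  z^k · Σ_{n≥0} f n z^{-n}.

  record Laurent : Set c where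
    constructor lau
    field
      shift : ℤ
      coef  : ℕ → C

  coeff : Laurent → ℤ → C
  coeff (lau k f) m with k ℤ.- m
  ... | + n      = f n
  ... | -[1+ _ ] = 0#

  _≈L_ : Laurent → Laurent → Set ℓ
  x ≈L y = ∀ m → coeff x m ≈ coeff y m

  _+L_ : Laurent → Laurent → Laurent
  x +L y = lau k (λ n → coeff x (k ℤ.- + n) + coeff y (k ℤ.- + n))
    where k = Laurent.shift x ⊔ Laurent.shift y

  -L_ : Laurent → Laurent
  -L (lau k f) = lau k (λ n → - f n)

  _-L_ : Laurent → Laurent → Laurent
  x -L y = x +L (-L y)

  cauchy : (ℕ → C) → (ℕ → C) → ℕ → C
  cauchy f g n = sumL (map (λ i → f i * g (n ∸ i)) (upTo (suc n)))

  _*L_ : Laurent → Laurent → Laurent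
  lau k f *L lau l g = lau (k ℤ.+ l) (cauchy f g)

  _·L_ : C → Laurent → Laurent
  r ·L lau k f = lau k (λ n → r * f n)

  δ : ℕ → C
  δ zero    = 1#
  δ (suc _) = 0#

  0L 1L zL : Laurent
  0L = lau (+ 0) (λ _ → 0#)
  1L = lau (+ 0) δ
  zL = lau (+ 1) δ

  series : (ℕ → C) → Laurent
  series f = lau -[1+ 0 ] f

  Rser : ℕ → Laurent
  Rser j = series (λ n → Rc n j)

  Sser : (q j : ℕ) → Laurent
  Sser q j = series (λ n → Sc q n j)

  Tser : (q j : ℕ) → Laurent
  Tser q j = series (λ n → Tc q n j)

  -- index-shifted versions with the convention S_{-1} ≡ T_{-1} ≡ 1:
  -- Sm1 q k = S^(q)_{k-1},  Tm1 q k = T^(q)_{k-1}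
  Sm1 : (q k : ℕ) → Laurent
  Sm1 q zero    = 1L
  Sm1 q (suc k) = Sser q k

  Tm1 : (q k : ℕ) → Laurent
  Tm1 q zero    = 1L
  Tm1 q (suc k) = Tser q k

  Fsum : Laurent
  Fsum = foldr _+L_ 0L
           (map (λ l → a (ℤ.- + l) ·L (Sm1 1 (p ∸ l) *L Tm1 1 l)) (upTo (suc p)))

-- Every series of the statement is a weighted path sum, and every path sum obeys the first-step
-- recursion  P_h(n+1 → j) = P_{h+1}(n → j) + a_{h-p} P_{h-p}(n → j);  the enumerations of the
-- definitions can be traded once and for all for this recursion.
-- A path from 0 to j > i, cut at its last visit to height i, is a path from 0 to i, an upstep, and
-- a path from i+1 to j staying at height ≥ i+1: this is R_j = R_i S^{(i+1)}_{j-i-1}.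
-- A path from 0 to 0, cut at its last visit to 0 before the end, gives R_0 = z⁻¹ + R_0 E, where E
-- is the series of first returns to 0. A first return starting with a downstep goes to -p and
-- then stays ≤ -1 until its final upstep (the term a_{-p} T^{(1)}_{p-1}); one starting with an
-- upstep stays ≥ 1 until it steps down from p-ℓ to -ℓ (S^{(1)}_{p-ℓ-1}), and then again stays
-- ≤ -1 until its final upstep (T^{(1)}_{ℓ-1}). Hence z E is the sum F of the denominator, and
-- R_0 = z⁻¹ + R_0 E is R_0 (z - F) = 1.
module Submission where

open import Defs
open import Algebra.Bundles using (CommutativeRing)
import Algebra.Properties.CommutativeSemigroup as CommutativeSemigroupProperties
import Algebra.Properties.Ring as RingProperties
open import Data.Bool using (Bool; true; false; if_then_else_; _∧_)
import Data.Bool.Properties as BP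
open import Data.Empty using (⊥-elim)
open import Data.Integer as ℤ using (ℤ; +_; -[1+_])
import Data.Integer.Properties as ℤP
open import Data.List using ([]; _∷_; map; _++_; foldr; upTo; applyUpTo)
import Data.List.Properties as LP
open import Data.Nat as ℕ using (ℕ; zero; suc; z≤n; s≤s; _≤_; _<_; _∸_)
import Data.Nat.Properties as ℕP
open import Data.Product using (_×_; _,_)
open import Data.Vec using (Vec; []; _∷_)
open import Function using (_∘_)
open import Function.Bundles using (_⇔_; mk⇔)
open import Relation.Binary.Definitions using (tri<; tri≈; tri>)
open import Relation.Binary.PropositionalEquality as P using (_≡_; _≢_)
open import Relation.Nullary using (¬_; yes; no)
open import Relation.Nullary.Decidable using (⌊_⌋; Dec; does-⇔; isYes≗does; dec-true; dec-false)
open import Relation.Nullary.Decidable.Core using (_×-dec_)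

open CommutativeSemigroupProperties ℤP.+-commutativeSemigroup using () renaming (xy∙z≈xz∙y to i+j+k≡i+k+j)

⌊⌋-⇔ : ∀ {A B : Set} → A ⇔ B → (a? : Dec A) (b? : Dec B) → ⌊ a? ⌋ ≡ ⌊ b? ⌋
⌊⌋-⇔ A⇔B a? b? = P.trans (isYes≗does a?) (P.trans (does-⇔ A⇔B a? b?) (P.sym (isYes≗does b?)))

⌊×-dec⌋ : ∀ {A B : Set} (a? : Dec A) (b? : Dec B) → ⌊ a? ×-dec b? ⌋ ≡ ⌊ a? ⌋ ∧ ⌊ b? ⌋
⌊×-dec⌋ a? b? = P.trans (isYes≗does (a? ×-dec b?)) (P.sym (P.cong₂ _∧_ (isYes≗does a?) (isYes≗does b?)))

⌊⌋-true : ∀ {A : Set} (a? : Dec A) → A → ⌊ a? ⌋ ≡ true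
⌊⌋-true a? a = P.trans (isYes≗does a?) (dec-true a? a)

⌊⌋-false : ∀ {A : Set} (a? : Dec A) → ¬ A → ⌊ a? ⌋ ≡ false
⌊⌋-false a? ¬a = P.trans (isYes≗does a?) (dec-false a? ¬a)

i<i+1 : ∀ i → i ℤ.< i ℤ.+ + 1
i<i+1 i = P.subst (ℤ._< i ℤ.+ + 1) (ℤP.+-identityʳ i) (ℤP.+-monoʳ-< i (ℤ.+<+ (s≤s z≤n)))

i<j⇒i+1≤j : ∀ {i j} → i ℤ.< j → i ℤ.+ + 1 ℤ.≤ j
i<j⇒i+1≤j {i} {j} i<j = P.subst (ℤ._≤ j) (ℤP.+-comm (+ 1) i) (ℤP.i<j⇒suc[i]≤j i<j)

i-j+j≡i : ∀ i j → i ℤ.- j ℤ.+ j ≡ i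
i-j+j≡i i j = P.trans (ℤP.+-assoc i (ℤ.- j) j) (P.trans (P.cong (λ x → i ℤ.+ x) (ℤP.+-inverseˡ j)) (ℤP.+-identityʳ i))

i-[i-j]≡j : ∀ i j → i ℤ.- (i ℤ.- j) ≡ j
i-[i-j]≡j i j =
  P.trans (P.cong (λ x → i ℤ.+ x) (P.trans (ℤP.neg-distrib-+ i (ℤ.- j)) (P.cong (λ x → ℤ.- i ℤ.+ x) (ℤP.neg-involutive j))))
               (P.trans (P.sym (ℤP.+-assoc i (ℤ.- i) j)) (P.trans (P.cong (ℤ._+ j) (ℤP.+-inverseʳ i)) (ℤP.+-identityˡ j)))

i-j≡+n⇒j≤i : ∀ {i j n} → i ℤ.- j ≡ + n → j ℤ.≤ i
i-j≡+n⇒j≤i {i} {j} {n} i-j≡n =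
  P.subst (j ℤ.≤_) (P.trans (P.cong (ℤ._+ j) (P.sym i-j≡n)) (i-j+j≡i i j)) (ℤP.i≤j+i j (+ n))

i-j≡-[1+n]⇒i<j : ∀ {i j n} → i ℤ.- j ≡ -[1+ n ] → i ℤ.< j
i-j≡-[1+n]⇒i<j {i} {j} {n} i-j≡-1-n =
  P.subst₂ ℤ._<_ (P.trans (P.cong (ℤ._+ j) (P.sym i-j≡-1-n)) (i-j+j≡i i j)) (ℤP.+-identityˡ j)
                 (ℤP.+-monoˡ-< j (ℤ.-<+ {n} {0}))

atLeast atMost : ℤ → ℤ → Bool
atLeast L x = ⌊ L ℤ.≤? x ⌋
atMost  M x = ⌊ x ℤ.≤? M ⌋

atLeast-⊓ : ∀ L x y → atLeast L (x ℤ.⊓ y) ≡ atLeast L x ∧ atLeast L y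
atLeast-⊓ L x y = P.trans (⌊⌋-⇔
  (mk⇔ (λ L≤x⊓y → ℤP.≤-trans L≤x⊓y (ℤP.i⊓j≤i x y) , ℤP.≤-trans L≤x⊓y (ℤP.i⊓j≤j x y))
       (λ (L≤x , L≤y) → ℤP.⊓-glb L≤x L≤y))
  (L ℤ.≤? x ℤ.⊓ y) ((L ℤ.≤? x) ×-dec (L ℤ.≤? y))) (⌊×-dec⌋ (L ℤ.≤? x) (L ℤ.≤? y))

atMost-⊔ : ∀ M x y → atMost M (x ℤ.⊔ y) ≡ atMost M x ∧ atMost M y
atMost-⊔ M x y = P.trans (⌊⌋-⇔
  (mk⇔ (λ x⊔y≤M → ℤP.≤-trans (ℤP.i≤i⊔j x y) x⊔y≤M , ℤP.≤-trans (ℤP.i≤j⊔i x y) x⊔y≤M)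
       (λ (x≤M , y≤M) → ℤP.⊔-lub x≤M y≤M))
  (x ℤ.⊔ y ℤ.≤? M) ((x ℤ.≤? M) ×-dec (y ℤ.≤? M))) (⌊×-dec⌋ (x ℤ.≤? M) (y ℤ.≤? M))

i+j-j≡i : ∀ i j → i ℤ.+ j ℤ.- j ≡ i
i+j-j≡i i j = P.trans (ℤP.+-assoc i j (ℤ.- j)) (P.trans (P.cong (λ x → i ℤ.+ x) (ℤP.+-inverseʳ j)) (ℤP.+-identityʳ i))

≟-+-invariant : ∀ x y d → ⌊ x ℤ.+ d ℤ.≟ y ℤ.+ d ⌋ ≡ ⌊ x ℤ.≟ y ⌋
≟-+-invariant x y d = ⌊⌋-⇔
  (mk⇔ (λ eq → P.trans (P.sym (i+j-j≡i x d)) (P.trans (P.cong (ℤ._- d) eq) (i+j-j≡i y d))) (P.cong (ℤ._+ d)))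
  (x ℤ.+ d ℤ.≟ y ℤ.+ d) (x ℤ.≟ y)

≤?-+-invariant : ∀ x y d → ⌊ x ℤ.+ d ℤ.≤? y ℤ.+ d ⌋ ≡ ⌊ x ℤ.≤? y ⌋
≤?-+-invariant x y d = ⌊⌋-⇔
  (mk⇔ (λ le → P.subst₂ ℤ._≤_ (i+j-j≡i x d) (i+j-j≡i y d) (ℤP.+-monoˡ-≤ (ℤ.- d) le)) (ℤP.+-monoˡ-≤ d))
  (x ℤ.+ d ℤ.≤? y ℤ.+ d) (x ℤ.≤? y)

i≤j⇒⌊i≟j⌋≡⌊j≤?i⌋ : ∀ {i j} → i ℤ.≤ j → ⌊ i ℤ.≟ j ⌋ ≡ ⌊ j ℤ.≤? i ⌋
i≤j⇒⌊i≟j⌋≡⌊j≤?i⌋ {i} {j} i≤j =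
  ⌊⌋-⇔ (mk⇔ (λ i≡j → ℤP.≤-reflexive (P.sym i≡j)) (ℤP.≤-antisym i≤j)) (i ℤ.≟ j) (j ℤ.≤? i)

j≤i⇒⌊i≟j⌋≡⌊i≤?j⌋ : ∀ {i j} → j ℤ.≤ i → ⌊ i ℤ.≟ j ⌋ ≡ ⌊ i ℤ.≤? j ⌋
j≤i⇒⌊i≟j⌋≡⌊i≤?j⌋ {i} {j} j≤i =
  ⌊⌋-⇔ (mk⇔ ℤP.≤-reflexive (λ i≤j → ℤP.≤-antisym i≤j j≤i)) (i ℤ.≟ j) (i ℤ.≤? j)

-k-1≡-[1+k] : ∀ k → ℤ.- + k ℤ.- + 1 ≡ -[1+ k ]
-k-1≡-[1+k] zero    = P.refl
-k-1≡-[1+k] (suc k) = P.cong (λ x → -[1+ suc x ]) (ℕP.+-identityʳ k)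

module LatticePaths {c ℓ} (R : CommutativeRing c ℓ) (p : ℕ) (a : ℤ → CommutativeRing.Carrier R) where
  open CommutativeRing R renaming (Carrier to C)
  open Paths R p a
  open import Relation.Binary.Reasoning.Setoid setoid
  open RingProperties ring using (-‿distribʳ-*; -‿+-comm; -0#≈0#)
  open CommutativeSemigroupProperties +-commutativeSemigroup using (interchange; x∙yz≈y∙xz)

  sumL-++ : ∀ xs ys → sumL (xs ++ ys) ≈ sumL xs + sumL ys
  sumL-++ []       ys = sym (+-identityˡ _)
  sumL-++ (x ∷ xs) ys = trans (+-congˡ (sumL-++ xs ys)) (sym (+-assoc _ _ _))

  module _ {A : Set} where
    sumL-map-cong : ∀ {f g : A → C} xs → (∀ x → f x ≈ g x) → sumL (map f xs) ≈ sumL (map g xs)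
    sumL-map-cong []       f≈g = refl
    sumL-map-cong (x ∷ xs) f≈g = +-cong (f≈g x) (sumL-map-cong xs f≈g)

    sumL-map-+ : ∀ (f g : A → C) xs → sumL (map (λ x → f x + g x) xs) ≈ sumL (map f xs) + sumL (map g xs)
    sumL-map-+ f g []       = sym (+-identityˡ _)
    sumL-map-+ f g (x ∷ xs) = trans (+-congˡ (sumL-map-+ f g xs)) (interchange _ _ _ _)

    sumL-map-*ˡ : ∀ r (f : A → C) xs → sumL (map (λ x → r * f x) xs) ≈ r * sumL (map f xs)
    sumL-map-*ˡ r f []       = sym (zeroʳ r)
    sumL-map-*ˡ r f (x ∷ xs) = trans (+-congˡ (sumL-map-*ˡ r f xs)) (sym (distribˡ r _ _))

    sumL-map-0 : ∀ (f : A → C) xs → (∀ x → f x ≈ 0#) → sumL (map f xs) ≈ 0#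
    sumL-map-0 f []       f≈0 = refl
    sumL-map-0 f (x ∷ xs) f≈0 = trans (+-cong (f≈0 x) (sumL-map-0 f xs f≈0)) (+-identityˡ 0#)

    sumL-map-neg : ∀ (f : A → C) xs → sumL (map (λ x → - f x) xs) ≈ - sumL (map f xs)
    sumL-map-neg f []       = sym -0#≈0#
    sumL-map-neg f (x ∷ xs) = trans (+-congˡ (sumL-map-neg f xs)) (-‿+-comm _ _)

  sumUpTo : ℕ → (ℕ → C) → C
  sumUpTo n F = sumL (map F (upTo n))

  map-applyUpTo-suc : ∀ {b} {A : Set b} (F : ℕ → A) n → map F (applyUpTo suc n) ≡ map (F ∘ suc) (upTo n)
  map-applyUpTo-suc F n = P.trans (LP.map-applyUpTo suc F n) (P.sym (LP.map-applyUpTo (λ i → i) (F ∘ suc) n))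

  sumUpTo-suc : ∀ n F → sumUpTo (suc n) F ≈ sumUpTo n F + F n
  sumUpTo-suc n F = begin
    sumL (map F (upTo (suc n)))         ≡⟨ P.cong (λ xs → sumL (map F xs)) (P.sym (LP.applyUpTo-∷ʳ (λ i → i) n)) ⟩
    sumL (map F (upTo n ++ (n ∷ [])))   ≡⟨ P.cong sumL (LP.map-++ F (upTo n) (n ∷ [])) ⟩
    sumL (map F (upTo n) ++ (F n ∷ [])) ≈⟨ sumL-++ (map F (upTo n)) (F n ∷ []) ⟩
    sumUpTo n F + (F n + 0#)            ≈⟨ +-congˡ (+-identityʳ _) ⟩
    sumUpTo n F + F n                   ∎

  sumUpTo-cong : ∀ n {F G} → (∀ l → l < n → F l ≈ G l) → sumUpTo n F ≈ sumUpTo n G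
  sumUpTo-cong zero    F≈G = refl
  sumUpTo-cong (suc n) {F} {G} F≈G = begin
    sumUpTo (suc n) F  ≈⟨ sumUpTo-suc n F ⟩
    sumUpTo n F + F n  ≈⟨ +-cong (sumUpTo-cong n (λ l l<n → F≈G l (ℕP.m<n⇒m<1+n l<n))) (F≈G n ℕP.≤-refl) ⟩
    sumUpTo n G + G n  ≈⟨ sumUpTo-suc n G ⟨
    sumUpTo (suc n) G  ∎

  sumUpTo-0 : ∀ n F → (∀ l → l < n → F l ≈ 0#) → sumUpTo n F ≈ 0#
  sumUpTo-0 n F F≈0 = trans (sumUpTo-cong n F≈0) (sumL-map-0 (λ _ → 0#) (upTo n) (λ _ → refl))

  sumUpTo-single : ∀ n F t → t < n → (∀ l → l < n → l ≢ t → F l ≈ 0#) → sumUpTo n F ≈ F t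
  sumUpTo-single (suc n) F t t<1+n F≈0 with t ℕ.≟ n
  ... | yes P.refl = begin
    sumUpTo (suc n) F  ≈⟨ sumUpTo-suc n F ⟩
    sumUpTo n F + F n  ≈⟨ +-congʳ (sumUpTo-0 n F (λ l l<n → F≈0 l (ℕP.m<n⇒m<1+n l<n) (ℕP.<⇒≢ l<n))) ⟩
    0# + F n           ≈⟨ +-identityˡ _ ⟩
    F n                ∎
  ... | no t≢n = begin
    sumUpTo (suc n) F  ≈⟨ sumUpTo-suc n F ⟩
    sumUpTo n F + F n  ≈⟨ +-cong (sumUpTo-single n F t (ℕP.≤∧≢⇒< (ℕP.≤-pred t<1+n) t≢n)
                                    (λ l l<n → F≈0 l (ℕP.m<n⇒m<1+n l<n)))
                                 (F≈0 n ℕP.≤-refl (t≢n ∘ P.sym)) ⟩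
    F t + 0#           ≈⟨ +-identityʳ _ ⟩
    F t                ∎

  cauchy-zero : ∀ f g → cauchy f g 0 ≈ f 0 * g 0
  cauchy-zero f g = +-identityʳ _

  cauchy-suc : ∀ f g n → cauchy f g (suc n) ≈ f 0 * g (suc n) + cauchy (f ∘ suc) g n
  cauchy-suc f g n = +-congˡ (reflexive (P.cong sumL (map-applyUpTo-suc _ (suc n))))

  cauchy-cong : ∀ {f f′ g g′} n → (∀ i → f i ≈ f′ i) → (∀ i → g i ≈ g′ i) → cauchy f g n ≈ cauchy f′ g′ n
  cauchy-cong n f≈f′ g≈g′ = sumL-map-cong (upTo (suc n)) (λ i → *-cong (f≈f′ i) (g≈g′ (n ∸ i)))

  cauchy-congˡ : ∀ {f f′} g n → (∀ i → f i ≈ f′ i) → cauchy f g n ≈ cauchy f′ g n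
  cauchy-congˡ g n f≈f′ = cauchy-cong n f≈f′ (λ i → refl {g i})

  cauchy-congʳ : ∀ f {g g′} n → (∀ i → g i ≈ g′ i) → cauchy f g n ≈ cauchy f g′ n
  cauchy-congʳ f n g≈g′ = cauchy-cong n (λ i → refl {f i}) g≈g′

  cauchy-distribʳ : ∀ f f′ g n → cauchy (λ i → f i + f′ i) g n ≈ cauchy f g n + cauchy f′ g n
  cauchy-distribʳ f f′ g n =
    trans (sumL-map-cong (upTo (suc n)) (λ i → distribʳ (g (n ∸ i)) (f i) (f′ i))) (sumL-map-+ _ _ (upTo (suc n)))

  cauchy-distribˡ : ∀ f g g′ n → cauchy f (λ i → g i + g′ i) n ≈ cauchy f g n + cauchy f g′ n
  cauchy-distribˡ f g g′ n =
    trans (sumL-map-cong (upTo (suc n)) (λ i → distribˡ (f i) (g (n ∸ i)) (g′ (n ∸ i)))) (sumL-map-+ _ _ (upTo (suc n)))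

  cauchy-*ˡ : ∀ r f g n → cauchy (λ i → r * f i) g n ≈ r * cauchy f g n
  cauchy-*ˡ r f g n =
    trans (sumL-map-cong (upTo (suc n)) (λ i → *-assoc r (f i) (g (n ∸ i)))) (sumL-map-*ˡ r _ (upTo (suc n)))

  cauchy-negʳ : ∀ f g n → cauchy f (λ i → - g i) n ≈ - cauchy f g n
  cauchy-negʳ f g n =
    trans (sumL-map-cong (upTo (suc n)) (λ i → sym (-‿distribʳ-* (f i) (g (n ∸ i))))) (sumL-map-neg _ (upTo (suc n)))

  cauchy-zeroˡ : ∀ f g n → (∀ i → f i ≈ 0#) → cauchy f g n ≈ 0#
  cauchy-zeroˡ f g n f≈0 = sumL-map-0 _ (upTo (suc n)) (λ i → trans (*-congʳ (f≈0 i)) (zeroˡ _))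

  cauchy-identityʳ : ∀ f n → cauchy f δ n ≈ f n
  cauchy-identityʳ f zero    = trans (cauchy-zero f δ) (*-identityʳ _)
  cauchy-identityʳ f (suc n) = begin
    cauchy f δ (suc n)               ≈⟨ cauchy-suc f δ n ⟩
    f 0 * 0# + cauchy (f ∘ suc) δ n  ≈⟨ +-cong (zeroʳ _) (cauchy-identityʳ (f ∘ suc) n) ⟩
    0# + f (suc n)                   ≈⟨ +-identityˡ _ ⟩
    f (suc n)                        ∎

  cauchy-identityˡ : ∀ g n → cauchy δ g n ≈ g n
  cauchy-identityˡ g zero    = trans (cauchy-zero δ g) (*-identityˡ _)
  cauchy-identityˡ g (suc n) = begin
    cauchy δ g (suc n)                  ≈⟨ cauchy-suc δ g n ⟩
    1# * g (suc n) + cauchy (δ ∘ suc) g n  ≈⟨ +-cong (*-identityˡ _) (cauchy-zeroˡ _ g n (λ _ → refl)) ⟩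
    g (suc n) + 0#                      ≈⟨ +-identityʳ _ ⟩
    g (suc n)                           ∎

  delay : (ℕ → C) → ℕ → C
  delay g zero    = 0#
  delay g (suc n) = g n

  cauchy-delay-zero : ∀ f g → cauchy f (delay g) 0 ≈ 0#
  cauchy-delay-zero f g = trans (cauchy-zero f (delay g)) (zeroʳ _)

  cauchy-delay : ∀ f g n → cauchy f (delay g) (suc n) ≈ cauchy f g n
  cauchy-delay f g zero = +-congˡ (cauchy-delay-zero (f ∘ suc) g)
  cauchy-delay f g (suc n) = begin
    cauchy f (delay g) (suc (suc n))                       ≈⟨ cauchy-suc f (delay g) (suc n) ⟩
    f 0 * g (suc n) + cauchy (f ∘ suc) (delay g) (suc n)   ≈⟨ +-congˡ (cauchy-delay (f ∘ suc) g n) ⟩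
    f 0 * g (suc n) + cauchy (f ∘ suc) g n                 ≈⟨ cauchy-suc f g n ⟨
    cauchy f g (suc n)                                     ∎

  -- Path sums and the first-step recursion

  if-*ˡ : ∀ b x w → (if b then x * w else 0#) ≈ x * (if b then w else 0#)
  if-*ˡ true  x w = refl
  if-*ˡ false x w = sym (zeroʳ x)

  if-identityˡ : ∀ b w → (if b then 1# * w else 0#) ≈ (if b then w else 0#)
  if-identityˡ true  w = *-identityˡ w
  if-identityˡ false w = refl

  stays : (ℤ → Bool) → ∀ {n} → ℤ → Vec Bool n → Bool
  stays ok h []      = ok h
  stays ok h (b ∷ s) = ok h ∧ stays ok (next h b) s

  admissibleWeight : (ℤ → Bool) → ℤ → ℤ → ∀ {n} → Vec Bool n → C
  admissibleWeight ok h j s = if (endH h s == j) ∧ stays ok h s then weight h s else 0#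

  pathSum : (ℤ → Bool) → ℤ → ℕ → ℤ → C
  pathSum ok h n j = sumL (map (admissibleWeight ok h j) (allVec n))

  walks : (ℤ → Bool) → ℤ → ℕ → ℤ → C
  walks ok h zero    j = if ok h ∧ (h == j) then 1# else 0#
  walks ok h (suc n) j =
    if ok h then walks ok (next h true) n j + a (next h false) * walks ok (next h false) n j else 0#

  sumL-allVec-suc : ∀ n (F : Vec Bool (suc n) → C) →
    sumL (map F (allVec (suc n))) ≈ sumL (map (F ∘ (true ∷_)) (allVec n)) + sumL (map (F ∘ (false ∷_)) (allVec n))
  sumL-allVec-suc n F = begin
    sumL (map F (map (true ∷_) A ++ map (false ∷_) A))
      ≡⟨ P.cong sumL (LP.map-++ F (map (true ∷_) A) (map (false ∷_) A)) ⟩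
    sumL (map F (map (true ∷_) A) ++ map F (map (false ∷_) A))
      ≈⟨ sumL-++ (map F (map (true ∷_) A)) _ ⟩
    sumL (map F (map (true ∷_) A)) + sumL (map F (map (false ∷_) A))
      ≡⟨ P.cong₂ _+_ (P.cong sumL (P.sym (LP.map-∘ A))) (P.cong sumL (P.sym (LP.map-∘ A))) ⟩
    sumL (map (F ∘ (true ∷_)) A) + sumL (map (F ∘ (false ∷_)) A) ∎
    where A = allVec n

  pathSum≈walks : ∀ ok h n j → pathSum ok h n j ≈ walks ok h n j
  pathSum≈walks ok h zero j =
    trans (+-identityʳ _) (reflexive (P.cong (λ b → if b then 1# else 0#) (BP.∧-comm (h == j) (ok h))))
  pathSum≈walks ok h (suc n) j with ok h in ok-h
  ... | true = begin
    pathSum ok h (suc n) j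
      ≈⟨ sumL-allVec-suc n (admissibleWeight ok h j) ⟩
    sumL (map (admissibleWeight ok h j ∘ (true ∷_)) (allVec n)) + sumL (map (admissibleWeight ok h j ∘ (false ∷_)) (allVec n))
      ≈⟨ +-cong (sumL-map-cong (allVec n) up) (trans (sumL-map-cong (allVec n) down) (sumL-map-*ˡ _ _ (allVec n))) ⟩
    pathSum ok (next h true) n j + a (next h false) * pathSum ok (next h false) n j
      ≈⟨ +-cong (pathSum≈walks ok _ n j) (*-congˡ (pathSum≈walks ok _ n j)) ⟩
    walks ok (next h true) n j + a (next h false) * walks ok (next h false) n j ∎
    where
    drop-ok : ∀ e s w → (if e ∧ (ok h ∧ s) then w else 0#) ≡ (if e ∧ s then w else 0#)
    drop-ok e s w = P.cong (λ o → if e ∧ (o ∧ s) then w else 0#) ok-h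
    up : ∀ s → admissibleWeight ok h j (true ∷ s) ≈ admissibleWeight ok (next h true) j s
    up s = trans (reflexive (drop-ok (endH (next h true) s == j) (stays ok (next h true) s) _)) (if-identityˡ _ _)
    down : ∀ s → admissibleWeight ok h j (false ∷ s) ≈ a (next h false) * admissibleWeight ok (next h false) j s
    down s = trans (reflexive (drop-ok (endH (next h false) s == j) (stays ok (next h false) s) _)) (if-*ˡ _ _ _)
  ... | false = sumL-map-0 _ (allVec (suc n)) leaves
    where
    leaves : ∀ s → admissibleWeight ok h j s ≈ 0#
    leaves (b ∷ s) = reflexive (P.trans (P.cong (λ o → if e ∧ (o ∧ stays ok (next h b) s) then weight h (b ∷ s) else 0#) ok-h)
                                        (P.cong (λ x → if x then weight h (b ∷ s) else 0#) (BP.∧-zeroʳ e)))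
      where e = endH (next h b) s == j

  walks-blocked : ∀ {ok h} → ok h ≡ false → ∀ n j → walks ok h n j ≡ 0#
  walks-blocked ok-h zero    j rewrite ok-h = P.refl
  walks-blocked ok-h (suc n) j rewrite ok-h = P.refl

  walks-suc : ∀ {ok h} → ok h ≡ true → ∀ n j →
    walks ok h (suc n) j ≡ walks ok (next h true) n j + a (next h false) * walks ok (next h false) n j
  walks-suc ok-h n j rewrite ok-h = P.refl

  walks-0-≢ : ∀ ok {h j} → h ≢ j → walks ok h 0 j ≈ 0#
  walks-0-≢ ok {h} {j} h≢j = reflexive (P.trans (P.cong (λ b → if ok h ∧ b then 1# else 0#) (⌊⌋-false (h ℤ.≟ j) h≢j))
                                                 (P.cong (λ b → if b then 1# else 0#) (BP.∧-zeroʳ (ok h))))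

  walks-0-refl : ∀ ok {h} → ok h ≡ true → walks ok h 0 h ≈ 1#
  walks-0-refl ok {h} ok-h = reflexive (P.cong₂ (λ o b → if o ∧ b then 1# else 0#) ok-h (⌊⌋-true (h ℤ.≟ h) P.refl))

  paths : ℤ → ℕ → ℤ → C
  paths = walks (λ _ → true)

  paths-0-≢ : ∀ {h j} → h ≢ j → paths h 0 j ≈ 0#
  paths-0-≢ = walks-0-≢ (λ _ → true)

  paths-0-refl : ∀ h → paths h 0 h ≈ 1#
  paths-0-refl h = walks-0-refl (λ _ → true) P.refl

  stays-true : ∀ {n} h (s : Vec Bool n) → stays (λ _ → true) h s ≡ true
  stays-true h []      = P.refl
  stays-true h (b ∷ s) = stays-true (next h b) s

  Rc≈paths : ∀ n j → Rc n j ≈ paths (+ 0) n (+ j)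
  Rc≈paths n j = trans (sumL-map-cong (allVec n) λ s → reflexive (P.cong (λ b → if b then weight (+ 0) s else 0#) (unconstrained s)))
                       (pathSum≈walks _ (+ 0) n (+ j))
    where
    unconstrained : ∀ s → (endH (+ 0) s == + j) ≡ (endH (+ 0) s == + j) ∧ stays (λ _ → true) (+ 0) s
    unconstrained s = P.sym (P.trans (P.cong ((endH (+ 0) s == + j) ∧_) (stays-true (+ 0) s)) (BP.∧-identityʳ _))

  -- Vertical shifts of paths

  next-+ : ∀ h d b → next (h ℤ.+ d) b ≡ next h b ℤ.+ d
  next-+ h d true  = i+j+k≡i+k+j h d (+ 1)
  next-+ h d false = i+j+k≡i+k+j h d (ℤ.- + p)

  next-false≤ : ∀ h → next h false ℤ.≤ h
  next-false≤ h = ℤP.i≤j⇒i-k≤j (+ p) ℤP.≤-refl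

  endH-+ : ∀ {n} h d (s : Vec Bool n) → endH (h ℤ.+ d) s ≡ endH h s ℤ.+ d
  endH-+ h d []      = P.refl
  endH-+ h d (b ∷ s) = P.trans (P.cong (λ x → endH x s) (next-+ h d b)) (endH-+ (next h b) d s)

  minH-+ : ∀ {n} h d (s : Vec Bool n) → minH (h ℤ.+ d) s ≡ minH h s ℤ.+ d
  minH-+ h d []      = P.refl
  minH-+ h d (b ∷ s) = P.trans (P.cong ((h ℤ.+ d) ℤ.⊓_)
                                       (P.trans (P.cong (λ x → minH x s) (next-+ h d b)) (minH-+ (next h b) d s)))
                               (P.sym (ℤP.mono-≤-distrib-⊓ (ℤP.+-monoˡ-≤ d) h (minH (next h b) s)))

  maxH-+ : ∀ {n} h d (s : Vec Bool n) → maxH (h ℤ.+ d) s ≡ maxH h s ℤ.+ d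
  maxH-+ h d []      = P.refl
  maxH-+ h d (b ∷ s) = P.trans (P.cong ((h ℤ.+ d) ℤ.⊔_)
                                       (P.trans (P.cong (λ x → maxH x s) (next-+ h d b)) (maxH-+ (next h b) d s)))
                               (P.sym (ℤP.mono-≤-distrib-⊔ (ℤP.+-monoˡ-≤ d) h (maxH (next h b) s)))

  minH≤start : ∀ {n} h (s : Vec Bool n) → minH h s ℤ.≤ h
  minH≤start h []      = ℤP.≤-refl
  minH≤start h (b ∷ s) = ℤP.i⊓j≤i h _

  endH≤maxH : ∀ {n} h (s : Vec Bool n) → endH h s ℤ.≤ maxH h s
  endH≤maxH h []      = ℤP.≤-refl
  endH≤maxH h (b ∷ s) = ℤP.≤-trans (endH≤maxH (next h b) s) (ℤP.i≤j⊔i h _)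

  atLeast-minH : ∀ L {n} h (s : Vec Bool n) → atLeast L (minH h s) ≡ stays (atLeast L) h s
  atLeast-minH L h []      = P.refl
  atLeast-minH L h (b ∷ s) = P.trans (atLeast-⊓ L h _) (P.cong (atLeast L h ∧_) (atLeast-minH L (next h b) s))

  atMost-maxH : ∀ M {n} h (s : Vec Bool n) → atMost M (maxH h s) ≡ stays (atMost M) h s
  atMost-maxH M h []      = P.refl
  atMost-maxH M h (b ∷ s) = P.trans (atMost-⊔ M h _) (P.cong (atMost M h ∧_) (atMost-maxH M (next h b) s))

  Sc≈walks : ∀ q n k → Sc q n k ≈ walks (atLeast (+ q)) (+ q) n (+ k ℤ.+ + q)
  Sc≈walks q n k = trans (sumL-map-cong (allVec n) λ s →
                             reflexive (P.cong (λ b → if b then weight (+ q) s else 0#) (P.sym (conditions s))))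
                         (pathSum≈walks _ _ n _)
    where
    conditions : ∀ s → (endH (+ q) s == + k ℤ.+ + q) ∧ stays (atLeast (+ q)) (+ q) s
                     ≡ (endH (+ 0) s == + k) ∧ (minH (+ 0) s == + 0)
    conditions s = P.cong₂ _∧_
      (P.trans (P.cong (_== + k ℤ.+ + q) (endH-+ (+ 0) (+ q) s)) (≟-+-invariant (endH (+ 0) s) (+ k) (+ q)))
      (P.trans (P.sym (atLeast-minH (+ q) (+ q) s))
      (P.trans (P.cong (atLeast (+ q)) (minH-+ (+ 0) (+ q) s))
      (P.trans (≤?-+-invariant (+ 0) (minH (+ 0) s) (+ q))
               (P.sym (i≤j⇒⌊i≟j⌋≡⌊j≤?i⌋ (minH≤start (+ 0) s))))))

  Tc≈walks : ∀ q n k → Tc q n k ≈ walks (atMost (+ 0 ℤ.- + q)) (ℤ.- + k ℤ.- + q) n (+ 0 ℤ.- + q)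
  Tc≈walks q n k = trans (sumL-map-cong (allVec n) λ s →
                             reflexive (P.cong (λ b → if b then weight (h ℤ.+ d) s else 0#) (P.sym (conditions s))))
                         (pathSum≈walks _ _ n _)
    where
    h d : ℤ
    h = ℤ.- + k
    d = ℤ.- + q
    reaches-0-from-below : ∀ {x y} → x ℤ.≤ y → (x == + 0) ∧ atMost (+ 0) y ≡ (x == + 0) ∧ (y == + 0)
    reaches-0-from-below {x} {y} x≤y with x ℤ.≟ + 0
    ... | yes P.refl = P.sym (j≤i⇒⌊i≟j⌋≡⌊i≤?j⌋ x≤y)
    ... | no _       = P.refl
    conditions : ∀ s → (endH (h ℤ.+ d) s == + 0 ℤ.+ d) ∧ stays (atMost (+ 0 ℤ.+ d)) (h ℤ.+ d) s
                     ≡ (endH h s == + 0) ∧ (maxH h s == + 0)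
    conditions s = P.trans (P.cong₂ _∧_
      (P.trans (P.cong (_== + 0 ℤ.+ d) (endH-+ h d s)) (≟-+-invariant (endH h s) (+ 0) d))
      (P.trans (P.sym (atMost-maxH (+ 0 ℤ.+ d) (h ℤ.+ d) s))
      (P.trans (P.cong (atMost (+ 0 ℤ.+ d)) (maxH-+ h d s))
               (≤?-+-invariant (maxH h s) (+ 0) d))))
      (reaches-0-from-below (endH≤maxH h s))

  -- Both sides satisfy the first-step recursion in h, with the same initial values.
  paths-renewal : ∀ i j (G : ℤ → ℕ → C) (K : ℕ → C) →
    (∀ h → paths h 0 j ≈ G h 0 + paths h 0 i * K 0) →
    (∀ h N → G (next h true) N + a (next h false) * G (next h false) N ≈ G h (suc N) + paths h 0 i * K (suc N)) →
    ∀ N h → paths h N j ≈ G h N + cauchy (λ k → paths h k i) K N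
  paths-renewal i j G K base step zero    h = trans (base h) (+-congˡ (sym (cauchy-zero (λ k → paths h k i) K)))
  paths-renewal i j G K base step (suc N) h = begin
    paths h₊ N j + a₀ * paths h₋ N j                              ≈⟨ +-cong (renewal N h₊) (*-congˡ (renewal N h₋)) ⟩
    (G h₊ N + Conv h₊ N) + a₀ * (G h₋ N + Conv h₋ N)              ≈⟨ regroup _ _ _ _ _ ⟩
    (G h₊ N + a₀ * G h₋ N) + (Conv h₊ N + a₀ * Conv h₋ N)          ≈⟨ +-congʳ (step h N) ⟩
    (G h (suc N) + paths h 0 i * K (suc N)) + (Conv h₊ N + a₀ * Conv h₋ N)  ≈⟨ +-assoc _ _ _ ⟩
    G h (suc N) + (paths h 0 i * K (suc N) + (Conv h₊ N + a₀ * Conv h₋ N))  ≈⟨ +-congˡ (sym conv-suc) ⟩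
    G h (suc N) + Conv h (suc N)                                   ∎
    where
    h₊ = next h true
    h₋ = next h false
    a₀ = a h₋
    renewal = paths-renewal i j G K base step
    Conv : ℤ → ℕ → C
    Conv h N = cauchy (λ k → paths h k i) K N
    regroup : ∀ x u r y v → (x + u) + r * (y + v) ≈ (x + r * y) + (u + r * v)
    regroup x u r y v = trans (+-congˡ (distribˡ r y v)) (interchange x u (r * y) (r * v))
    conv-suc : Conv h (suc N) ≈ paths h 0 i * K (suc N) + (Conv h₊ N + a₀ * Conv h₋ N)
    conv-suc = trans (cauchy-suc _ K N) (+-congˡ (trans (cauchy-distribʳ _ _ K N) (+-congˡ (cauchy-*ˡ a₀ _ K N))))

  paths-lastExit : ∀ {i j} → i ℤ.< j → ∀ N h →
    paths h N j ≈ walks (atLeast (i ℤ.+ + 1)) h N j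
                  + cauchy (λ k → paths h k i) (delay (λ m → walks (atLeast (i ℤ.+ + 1)) (i ℤ.+ + 1) m j)) N
  paths-lastExit {i} {j} i<j = paths-renewal i j above (delay (above L)) base step
    where
    L : ℤ
    L = i ℤ.+ + 1
    above : ℤ → ℕ → C
    above h N = walks (atLeast L) h N j
    below-L : ∀ {h} → h ℤ.< L → ∀ N → above h N ≡ 0#
    below-L {h} h<L N = walks-blocked (⌊⌋-false (L ℤ.≤? h) (ℤP.<⇒≱ h<L)) N j
    target-above : ∀ h → (h == j) ≡ atLeast L h ∧ (h == j)
    target-above h with h ℤ.≟ j
    ... | yes P.refl = P.sym (P.cong (_∧ true) (⌊⌋-true (L ℤ.≤? h) (i<j⇒i+1≤j i<j)))
    ... | no _       = P.sym (BP.∧-zeroʳ _)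
    base : ∀ h → paths h 0 j ≈ above h 0 + paths h 0 i * 0#
    base h = trans (reflexive (P.cong (λ b → if b then 1# else 0#) (target-above h)))
                   (sym (trans (+-congˡ (zeroʳ _)) (+-identityʳ _)))
    step : ∀ h N → above (next h true) N + a (next h false) * above (next h false) N
                   ≈ above h (suc N) + paths h 0 i * above L N
    step h N with ℤP.<-cmp i h
    ... | tri< i<h _ _ = begin
      above (next h true) N + a (next h false) * above (next h false) N
        ≡⟨ walks-suc (⌊⌋-true (L ℤ.≤? h) (i<j⇒i+1≤j i<h)) N j ⟨
      above h (suc N)                             ≈⟨ +-identityʳ _ ⟨
      above h (suc N) + 0#                        ≈⟨ +-congˡ (trans (*-congʳ (paths-0-≢ (ℤP.<⇒≢ i<h ∘ P.sym))) (zeroˡ _)) ⟨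
      above h (suc N) + paths h 0 i * above L N   ∎
    ... | tri≈ _ P.refl _ = begin
      above L N + a (next h false) * above (next h false) N
        ≡⟨ P.cong (λ x → above L N + a (next h false) * x) (below-L (ℤP.≤-<-trans (next-false≤ h) (i<i+1 h)) N) ⟩
      above L N + a (next h false) * 0#           ≈⟨ trans (+-congˡ (zeroʳ _)) (+-identityʳ _) ⟩
      above L N                                   ≈⟨ trans (*-congʳ (paths-0-refl h)) (*-identityˡ _) ⟨
      paths h 0 h * above L N                     ≈⟨ +-identityˡ _ ⟨
      0# + paths h 0 h * above L N                ≡⟨ P.cong (_+ paths h 0 h * above L N) (below-L (i<i+1 h) (suc N)) ⟨
      above h (suc N) + paths h 0 h * above L N   ∎
    ... | tri> _ _ h<i = begin
      above (next h true) N + a (next h false) * above (next h false) N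
        ≡⟨ P.cong₂ (λ x y → x + a (next h false) * y)
                   (below-L (ℤP.≤-<-trans (i<j⇒i+1≤j h<i) (i<i+1 i)) N)
                   (below-L (ℤP.≤-<-trans (next-false≤ h) h<L) N) ⟩
      0# + a (next h false) * 0#                  ≈⟨ +-congˡ (zeroʳ _) ⟩
      0# + 0#                                     ≈⟨ +-cong (reflexive (P.sym (below-L h<L (suc N))))
                                                            (sym (trans (*-congʳ (paths-0-≢ (ℤP.<⇒≢ h<i))) (zeroˡ _))) ⟩
      above h (suc N) + paths h 0 i * above L N   ∎
      where h<L = ℤP.<-trans h<i (i<i+1 i)

  -- Coefficients of Laurent series

  lau-cong : ∀ k {f g} → (∀ n → f n ≈ g n) → lau k f ≈L lau k g
  lau-cong k {f} {g} f≈g m with k ℤ.- m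
  ... | + n      = f≈g n
  ... | -[1+ _ ] = refl

  coeff-above-shift : ∀ x {m} → Laurent.shift x ℤ.< m → coeff x m ≈ 0#
  coeff-above-shift (lau k f) {m} k<m with k ℤ.- m in k-m
  ... | + n      = ⊥-elim (ℤP.<⇒≱ k<m (i-j≡+n⇒j≤i k-m))
  ... | -[1+ _ ] = refl

  coeff-+L : ∀ x y m → coeff (x +L y) m ≈ coeff x m + coeff y m
  coeff-+L x y m = coeff-sum (ℤP.i≤i⊔j _ _) (ℤP.i≤j⊔i _ _)
    where
    k = Laurent.shift x ℤ.⊔ Laurent.shift y
    coeff-sum : Laurent.shift x ℤ.≤ k → Laurent.shift y ℤ.≤ k →
      coeff (lau k (λ n → coeff x (k ℤ.- + n) + coeff y (k ℤ.- + n))) m ≈ coeff x m + coeff y m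
    coeff-sum x≤k y≤k with k ℤ.- m in k-m
    ... | + n = reflexive (P.cong₂ _+_ (P.cong (coeff x) k-n≡m) (P.cong (coeff y) k-n≡m))
      where k-n≡m = P.trans (P.cong (λ x → k ℤ.- x) (P.sym k-m)) (i-[i-j]≡j k m)
    ... | -[1+ _ ] = sym (trans (+-cong (coeff-above-shift x (ℤP.≤-<-trans x≤k k<m))
                                        (coeff-above-shift y (ℤP.≤-<-trans y≤k k<m)))
                                (+-identityˡ 0#))
      where k<m = i-j≡-[1+n]⇒i<j k-m

  coeff--L : ∀ x m → coeff (-L x) m ≈ - coeff x m
  coeff--L (lau k f) m with k ℤ.- m
  ... | + n      = refl
  ... | -[1+ _ ] = sym -0#≈0#

  coeff-·L : ∀ r x m → coeff (r ·L x) m ≈ r * coeff x m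
  coeff-·L r (lau k f) m with k ℤ.- m
  ... | + n      = refl
  ... | -[1+ _ ] = sym (zeroʳ r)

  coeff-0L : ∀ m → coeff 0L m ≈ 0#
  coeff-0L m with + 0 ℤ.- m
  ... | + n      = refl
  ... | -[1+ _ ] = refl

  coeff-Σ : ∀ (X : ℕ → Laurent) xs m → coeff (foldr _+L_ 0L (map X xs)) m ≈ sumL (map (λ l → coeff (X l) m) xs)
  coeff-Σ X []       m = coeff-0L m
  coeff-Σ X (x ∷ xs) m = trans (coeff-+L (X x) _ m) (+-congˡ (coeff-Σ X xs m))

  shift-Σ≤ : ∀ (X : ℕ → Laurent) xs {k} → (∀ l → Laurent.shift (X l) ℤ.≤ k) → + 0 ℤ.≤ k →
    Laurent.shift (foldr _+L_ 0L (map X xs)) ℤ.≤ k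
  shift-Σ≤ X []       X≤k 0≤k = 0≤k
  shift-Σ≤ X (x ∷ xs) X≤k 0≤k = ℤP.⊔-lub (X≤k x) (shift-Σ≤ X xs X≤k 0≤k)

  series≈L-delay : ∀ f g → (∀ n → f n ≈ delay g n) → series f ≈L lau -[1+ 1 ] g
  series≈L-delay f g f≈ (+ zero)     = refl
  series≈L-delay f g f≈ (+ suc n)    = refl
  series≈L-delay f g f≈ -[1+ zero ]  = f≈ 0
  series≈L-delay f g f≈ -[1+ suc n ] = f≈ (suc n)

  Rser-factor : ∀ {i j} → i < j → Rser j ≈L (Rser i *L Sm1 (suc i) (j ∸ i))
  Rser-factor {i} {j} i<j rewrite ℕP.+-∸-assoc 1 i<j = series≈L-delay _ _ coefficients
    where
    t = j ∸ suc i
    L = + i ℤ.+ + 1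
    toI exit : ℕ → C
    toI  k = paths (+ 0) k (+ i)
    exit m = walks (atLeast L) L m (+ j)
    exit≈Sc : ∀ m → exit m ≈ Sc (suc i) m t
    exit≈Sc m = sym (trans (Sc≈walks (suc i) m t)
      (reflexive (P.cong₂ (λ x y → walks (atLeast x) x m y) (P.cong +_ (ℕP.+-comm 1 i)) (P.cong +_ (ℕP.m∸n+n≡m i<j)))))
    coefficients : ∀ n → Rc n j ≈ delay (cauchy (λ k → Rc k i) (λ m → Sc (suc i) m t)) n
    coefficients zero    = trans (Rc≈paths 0 j) (paths-0-≢ (ℕP.<⇒≢ (ℕP.≤-<-trans z≤n i<j) ∘ ℤP.+-injective))
    coefficients (suc n) = begin
      Rc (suc n) j                                                ≈⟨ Rc≈paths (suc n) j ⟩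
      paths (+ 0) (suc n) (+ j)                                   ≈⟨ paths-lastExit (ℤ.+<+ i<j) (suc n) (+ 0) ⟩
      walks (atLeast L) (+ 0) (suc n) (+ j) + cauchy toI (delay exit) (suc n)
        ≈⟨ +-cong (reflexive (walks-blocked (⌊⌋-false (L ℤ.≤? + 0) (ℤP.<⇒≱ 0<L)) (suc n) (+ j))) (cauchy-delay toI exit n) ⟩
      0# + cauchy toI exit n                                      ≈⟨ +-identityˡ _ ⟩
      cauchy toI exit n                                           ≈⟨ cauchy-cong n (λ k → sym (Rc≈paths k i)) exit≈Sc ⟩
      cauchy (λ k → Rc k i) (λ m → Sc (suc i) m t) n              ∎
      where 0<L = ℤP.≤-<-trans (ℤ.+≤+ z≤n) (i<i+1 (+ i))

module FirstPassage {c ℓ} (R : CommutativeRing c ℓ) (p′ : ℕ) (a : ℤ → CommutativeRing.Carrier R) where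
  open CommutativeRing R renaming (Carrier to C)
  p : ℕ
  p = suc p′
  open Paths R p a
  open LatticePaths R p a
  open import Relation.Binary.Reasoning.Setoid setoid
  open CommutativeSemigroupProperties +-commutativeSemigroup using (x∙yz≈y∙xz)

  -- firstPassage h n weighs the paths of length n from h that reach 0 for the first time at
  -- their end; firstReturn n does the same for the paths from 0 that first return to 0 at step n.
  firstPassage : ℤ → ℕ → C
  firstPassage h zero    = if h == + 0 then 1# else 0#
  firstPassage h (suc n) =
    if h == + 0 then 0# else firstPassage (next h true) n + a (next h false) * firstPassage (next h false) n

  firstReturn : ℕ → C
  firstReturn zero    = 0#
  firstReturn (suc n) = firstPassage (next (+ 0) true) n + a (next (+ 0) false) * firstPassage (next (+ 0) false) n

  firstPassage-suc : ∀ {h} → h ≢ + 0 → ∀ n →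
    firstPassage h (suc n) ≡ firstPassage (next h true) n + a (next h false) * firstPassage (next h false) n
  firstPassage-suc {h} h≢0 n rewrite ⌊⌋-false (h ℤ.≟ + 0) h≢0 = P.refl

  firstPassage-zero-≢ : ∀ {h} → h ≢ + 0 → firstPassage h 0 ≡ 0#
  firstPassage-zero-≢ {h} h≢0 rewrite ⌊⌋-false (h ℤ.≟ + 0) h≢0 = P.refl

  paths-firstReturn : ∀ N h → paths h N (+ 0) ≈ firstPassage h N + cauchy (λ k → paths h k (+ 0)) firstReturn N
  paths-firstReturn = paths-renewal (+ 0) (+ 0) firstPassage firstReturn
    (λ h → sym (trans (+-congˡ (zeroʳ _)) (+-identityʳ _)))
    step
    where
    step : ∀ h N → firstPassage (next h true) N + a (next h false) * firstPassage (next h false) N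
                   ≈ firstPassage h (suc N) + paths h 0 (+ 0) * firstReturn (suc N)
    step h N with h ℤ.≟ + 0
    ... | yes P.refl = sym (trans (+-identityˡ _) (*-identityˡ _))
    ... | no _       = sym (trans (+-congˡ (zeroˡ _)) (+-identityʳ _))

  firstPassage-from-below : ∀ N h → h ℤ.≤ + 0 → firstPassage h (suc N) ≈ walks (atMost -[1+ 0 ]) h N -[1+ 0 ]
  firstPassage-from-below N h h≤0 with h ℤ.≟ + 0
  ... | yes P.refl = reflexive (P.sym (walks-blocked P.refl N _))
  ... | no h≢0     = lastStep N
    where
    h<0 : h ℤ.< + 0
    h<0 = ℤP.≤∧≢⇒< h≤0 h≢0
    h₋<0 : next h false ℤ.< + 0
    h₋<0 = ℤP.≤-<-trans (next-false≤ h) h<0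
    ok-h : atMost -[1+ 0 ] h ≡ true
    ok-h = ⌊⌋-true (h ℤ.≤? -[1+ 0 ]) (ℤP.i<j⇒i≤pred[j] h<0)
    lastStep : ∀ N → firstPassage (next h true) N + a (next h false) * firstPassage (next h false) N
                     ≈ walks (atMost -[1+ 0 ]) h N -[1+ 0 ]
    lastStep zero = begin
      firstPassage (next h true) 0 + a (next h false) * firstPassage (next h false) 0
        ≡⟨ P.cong (λ x → firstPassage (next h true) 0 + a (next h false) * x) (firstPassage-zero-≢ (ℤP.<⇒≢ h₋<0)) ⟩
      firstPassage (next h true) 0 + a (next h false) * 0#
        ≈⟨ trans (+-congˡ (zeroʳ _)) (+-identityʳ _) ⟩
      firstPassage (next h true) 0
        ≡⟨ P.cong (λ b → if b then 1# else 0#) (≟-+-invariant h -[1+ 0 ] (+ 1)) ⟩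
      (if h == -[1+ 0 ] then 1# else 0#)
        ≡⟨ P.cong (λ o → if o ∧ (h == -[1+ 0 ]) then 1# else 0#) ok-h ⟨
      walks (atMost -[1+ 0 ]) h 0 -[1+ 0 ] ∎
    lastStep (suc N) = begin
      firstPassage (next h true) (suc N) + a (next h false) * firstPassage (next h false) (suc N)
        ≈⟨ +-cong (firstPassage-from-below N _ (i<j⇒i+1≤j h<0)) (*-congˡ (firstPassage-from-below N _ (ℤP.<⇒≤ h₋<0))) ⟩
      walks (atMost -[1+ 0 ]) (next h true) N -[1+ 0 ] + a (next h false) * walks (atMost -[1+ 0 ]) (next h false) N -[1+ 0 ]
        ≡⟨ walks-suc ok-h N _ ⟨
      walks (atMost -[1+ 0 ]) h (suc N) -[1+ 0 ] ∎

  positiveWalks : ℤ → ℕ → ℕ → C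
  positiveWalks h l k = walks (atLeast (+ 1)) h k (+ (p ∸ l))

  -- A first passage from h ≥ 1 is cut at its first step below height 1, a downstep from p - l to -l
  -- with l < p; the landing terms collect the passages whose first step is already that downstep.
  crossing : ℤ → ℕ → ℕ → C
  crossing h N l = a (ℤ.- + l) * cauchy (positiveWalks h l) (delay (firstPassage (ℤ.- + l))) N

  crossings : ℤ → ℕ → C
  crossings h N = sumUpTo p (crossing h N)

  landingAt : ℤ → ℕ → ℕ → C
  landingAt h N l = a (ℤ.- + l) * (positiveWalks h l 0 * firstPassage (ℤ.- + l) N)

  landing : ℤ → ℕ → C
  landing h N = sumUpTo p (landingAt h N)

  landingAt-missed : ∀ h N l → positiveWalks h l 0 ≈ 0# → landingAt h N l ≈ 0#
  landingAt-missed h N l missed = trans (*-congˡ (trans (*-congʳ missed) (zeroˡ _))) (zeroʳ _)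

  crossings-zero : ∀ h → crossings h 0 ≈ 0#
  crossings-zero h = sumL-map-0 _ (upTo p) λ l →
    trans (*-congˡ (cauchy-delay-zero (positiveWalks h l) (firstPassage (ℤ.- + l)))) (zeroʳ _)

  crossings-below : ∀ {h} → h ℤ.< + 1 → ∀ N → crossings h N ≈ 0#
  crossings-below {h} h<1 N = sumL-map-0 _ (upTo p) λ l →
    trans (*-congˡ (cauchy-zeroˡ (positiveWalks h l) (delay (firstPassage (ℤ.- + l))) N
                                 (λ k → reflexive (walks-blocked (⌊⌋-false (+ 1 ℤ.≤? h) (ℤP.<⇒≱ h<1)) k _))))
          (zeroʳ _)

  crossings-suc : ∀ {h} → + 1 ℤ.≤ h → ∀ N →
    crossings h (suc N) ≈ landing h N + (crossings (next h true) N + a (next h false) * crossings (next h false) N)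
  crossings-suc {h} 1≤h N = begin
    sumUpTo p (crossing h (suc N))
      ≈⟨ sumL-map-cong (upTo p) (λ l → trans (*-congˡ (unfold l)) (rearrange _ _ _ _ _)) ⟩
    sumUpTo p (λ l → landingAt h N l + (crossing (next h true) N l + a₀ * crossing (next h false) N l))
      ≈⟨ sumL-map-+ (landingAt h N) _ (upTo p) ⟩
    landing h N + sumUpTo p (λ l → crossing (next h true) N l + a₀ * crossing (next h false) N l)
      ≈⟨ +-congˡ (trans (sumL-map-+ _ _ (upTo p)) (+-congˡ (sumL-map-*ˡ a₀ _ (upTo p)))) ⟩
    landing h N + (crossings (next h true) N + a₀ * crossings (next h false) N) ∎
    where
    a₀ = a (next h false)
    W = positiveWalks
    V : ℕ → ℕ → C
    V l = delay (firstPassage (ℤ.- + l))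
    ok-h = ⌊⌋-true (+ 1 ℤ.≤? h) 1≤h
    unfold : ∀ l → cauchy (W h l) (V l) (suc N)
                   ≈ W h l 0 * firstPassage (ℤ.- + l) N
                     + (cauchy (W (next h true) l) (V l) N + a₀ * cauchy (W (next h false) l) (V l) N)
    unfold l = trans (cauchy-suc (W h l) (V l) N) (+-congˡ (begin
      cauchy (W h l ∘ suc) (V l) N
        ≈⟨ cauchy-congˡ (V l) N (λ k → reflexive (walks-suc ok-h k _)) ⟩
      cauchy (λ k → W (next h true) l k + a₀ * W (next h false) l k) (V l) N
        ≈⟨ trans (cauchy-distribʳ _ _ (V l) N) (+-congˡ (cauchy-*ˡ a₀ _ (V l) N)) ⟩
      cauchy (W (next h true) l) (V l) N + a₀ * cauchy (W (next h false) l) (V l) N ∎))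
    rearrange : ∀ u x y w z → u * (x + (y + w * z)) ≈ u * x + (u * y + w * (u * z))
    rearrange u x y w z = trans (distribˡ u x _) (+-congˡ (trans (distribˡ u y _)
      (+-congˡ (trans (sym (*-assoc u w z)) (trans (*-congʳ (*-comm u w)) (*-assoc w u z))))))

  landing-≤p : ∀ {hn} → 1 ≤ hn → hn ≤ p → ∀ N →
    landing (+ hn) N ≈ a (next (+ hn) false) * firstPassage (next (+ hn) false) N
  landing-≤p {hn} 1≤hn hn≤p N = begin
    landing (+ hn) N
      ≈⟨ sumUpTo-single p (landingAt (+ hn) N) t t<p (λ l l<p l≢t → landingAt-missed (+ hn) N l (missed l l<p l≢t)) ⟩
    a (ℤ.- + t) * (positiveWalks (+ hn) t 0 * firstPassage (ℤ.- + t) N)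
      ≈⟨ *-congˡ (trans (*-congʳ hit) (*-identityˡ _)) ⟩
    a (ℤ.- + t) * firstPassage (ℤ.- + t) N
      ≡⟨ P.cong (λ x → a x * firstPassage x N) (ℤP.⊖-≤ hn≤p) ⟨
    a (next (+ hn) false) * firstPassage (next (+ hn) false) N ∎
    where
    t = p ∸ hn
    t<p : t < p
    t<p = ℕP.∸-monoʳ-< 1≤hn hn≤p
    ok-hn = ⌊⌋-true (+ 1 ℤ.≤? + hn) (ℤ.+≤+ 1≤hn)
    hit : positiveWalks (+ hn) t 0 ≈ 1#
    hit = trans (reflexive (P.cong (λ x → walks (atLeast (+ 1)) (+ hn) 0 (+ x)) (ℕP.m∸[m∸n]≡n hn≤p)))
                (walks-0-refl (atLeast (+ 1)) ok-hn)
    missed : ∀ l → l < p → l ≢ t → positiveWalks (+ hn) l 0 ≈ 0#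
    missed l l<p l≢t = walks-0-≢ (atLeast (+ 1)) {+ hn} {+ (p ∸ l)} λ hn≡p-l →
      l≢t (P.trans (P.sym (ℕP.m∸[m∸n]≡n (ℕP.<⇒≤ l<p))) (P.cong (p ∸_) (P.sym (ℤP.+-injective hn≡p-l))))

  landing->p : ∀ {hn} → p < hn → ∀ N → landing (+ hn) N ≈ 0#
  landing->p {hn} p<hn N = sumUpTo-0 p (landingAt (+ hn) N) λ l _ →
    landingAt-missed (+ hn) N l (walks-0-≢ (atLeast (+ 1)) {+ hn} {+ (p ∸ l)} (missed l))
    where
    missed : ∀ l → + hn ≢ + (p ∸ l)
    missed l hn≡p-l = ℕP.<-irrefl (P.sym (ℤP.+-injective hn≡p-l)) (ℕP.≤-<-trans (ℕP.m∸n≤m p l) p<hn)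

  +hn≢0 : ∀ {hn} → 1 ≤ hn → + hn ≢ + 0
  +hn≢0 1≤hn = ℕP.<⇒≢ 1≤hn ∘ P.sym ∘ ℤP.+-injective

  firstPassage-from-above : ∀ N {hn} → 1 ≤ hn → firstPassage (+ hn) N ≈ crossings (+ hn) N
  firstPassage-from-above zero {hn} 1≤hn =
    trans (reflexive (firstPassage-zero-≢ (+hn≢0 1≤hn))) (sym (crossings-zero (+ hn)))
  firstPassage-from-above (suc N) {hn} 1≤hn = begin
    firstPassage (+ hn) (suc N)
      ≡⟨ firstPassage-suc (+hn≢0 1≤hn) N ⟩
    firstPassage h₊ N + a₀ * firstPassage h₋ N
      ≈⟨ +-cong (firstPassage-from-above N (ℕP.≤-trans 1≤hn (ℕP.m≤m+n hn 1))) (downstep (hn ℕP.≤? p)) ⟩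
    crossings h₊ N + (landing (+ hn) N + a₀ * crossings h₋ N)
      ≈⟨ x∙yz≈y∙xz _ _ _ ⟩
    landing (+ hn) N + (crossings h₊ N + a₀ * crossings h₋ N)
      ≈⟨ crossings-suc (ℤ.+≤+ 1≤hn) N ⟨
    crossings (+ hn) (suc N) ∎
    where
    h₊ = next (+ hn) true
    h₋ = next (+ hn) false
    a₀ = a h₋
    downstep : Dec (hn ≤ p) → a₀ * firstPassage h₋ N ≈ landing (+ hn) N + a₀ * crossings h₋ N
    downstep (yes hn≤p) = sym (trans (+-cong (landing-≤p 1≤hn hn≤p N) (trans (*-congˡ (crossings-below h₋<1 N)) (zeroʳ _)))
                                     (+-identityʳ _))
      where
      h₋<1 : h₋ ℤ.< + 1
      h₋<1 = P.subst (ℤ._< + 1) (P.sym (ℤP.⊖-≤ hn≤p)) (ℤP.≤-<-trans ℤP.neg-≤-pos (ℤ.+<+ (s≤s z≤n)))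
    downstep (no hn≰p) = begin
      a₀ * firstPassage h₋ N              ≈⟨ *-congˡ (P.subst (λ x → firstPassage x N ≈ crossings x N) (P.sym h₋≡u)
                                                             (firstPassage-from-above N (ℕP.m<n⇒0<n∸m p<hn))) ⟩
      a₀ * crossings h₋ N                 ≈⟨ +-identityˡ _ ⟨
      0# + a₀ * crossings h₋ N            ≈⟨ +-congʳ (landing->p p<hn N) ⟨
      landing (+ hn) N + a₀ * crossings h₋ N ∎
      where
      p<hn = ℕP.≰⇒> hn≰p
      h₋≡u : h₋ ≡ + (hn ∸ p)
      h₋≡u = ℤP.≤-⊖ (ℕP.<⇒≤ p<hn)

  firstPassage-0≈δ : ∀ n → firstPassage (+ 0) n ≈ δ n
  firstPassage-0≈δ zero    = refl
  firstPassage-0≈δ (suc n) = refl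

  Sc≈walks-suc : ∀ n t → Sc 1 n t ≈ walks (atLeast (+ 1)) (+ 1) n (+ suc t)
  Sc≈walks-suc n t = trans (Sc≈walks 1 n t) (reflexive (P.cong (λ x → walks (atLeast (+ 1)) (+ 1) n (+ x)) (ℕP.+-comm t 1)))

  -- T^{(1)}_{l-1} weighs a path staying ≤ -1 from -l to -1, which becomes a first passage by a final upstep.
  Tc≈firstPassage : ∀ n l → Tc 1 n l ≈ firstPassage -[1+ l ] (suc n)
  Tc≈firstPassage n l = trans (Tc≈walks 1 n l)
    (trans (reflexive (P.cong (λ h → walks (atMost -[1+ 0 ]) h n -[1+ 0 ]) (-k-1≡-[1+k] l)))
           (sym (firstPassage-from-below n _ ℤ.-≤+)))

  term : ℕ → Laurent
  term l = a (ℤ.- + l) ·L (Sm1 1 (p ∸ l) *L Tm1 1 l)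

  term-shift<0 : ∀ l → Laurent.shift (term l) ℤ.< + 0
  term-shift<0 zero    = ℤ.-<+
  term-shift<0 (suc l) with p′ ∸ l
  ... | zero  = ℤ.-<+
  ... | suc _ = ℤ.-<+

  coeff-Fsum-nonneg : ∀ k → coeff Fsum (+ k) ≈ 0#
  coeff-Fsum-nonneg k = trans (coeff-Σ term (upTo (suc p)) (+ k))
    (sumL-map-0 _ (upTo (suc p)) (λ l → coeff-above-shift (term l) (ℤP.<-≤-trans (term-shift<0 l) (ℤ.+≤+ z≤n))))

  Fsum-shift≤0 : Laurent.shift Fsum ℤ.≤ + 0
  Fsum-shift≤0 = shift-Σ≤ term (upTo (suc p)) (λ l → ℤP.<⇒≤ (term-shift<0 l)) ℤP.≤-refl

  coeff-Sm1*Tm1 : ∀ {k} → 1 ≤ k → ∀ l e →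
    coeff (Sm1 1 k *L Tm1 1 l) -[1+ e ] ≈ cauchy (λ n → walks (atLeast (+ 1)) (+ 1) n (+ k)) (firstPassage (ℤ.- + l)) e
  coeff-Sm1*Tm1 {suc t} _ zero e = begin
    cauchy (λ n → Sc 1 n t) δ e                       ≈⟨ cauchy-identityʳ _ e ⟩
    Sc 1 e t                                          ≈⟨ Sc≈walks-suc e t ⟩
    W e                                               ≈⟨ cauchy-identityʳ W e ⟨
    cauchy W δ e                                      ≈⟨ cauchy-congʳ W e (λ n → sym (firstPassage-0≈δ n)) ⟩
    cauchy W (firstPassage (+ 0)) e                   ∎
    where
    W = λ n → walks (atLeast (+ 1)) (+ 1) n (+ suc t)
  coeff-Sm1*Tm1 {suc t} _ (suc l) e = trans (delayed e) (sym (cauchy-congʳ W e T≈))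
    where
    W = λ n → walks (atLeast (+ 1)) (+ 1) n (+ suc t)
    T≈ : ∀ n → firstPassage -[1+ l ] n ≈ delay (λ m → Tc 1 m l) n
    T≈ zero    = reflexive (firstPassage-zero-≢ { -[1+ l ]} (λ ()))
    T≈ (suc n) = sym (Tc≈firstPassage n l)
    delayed : ∀ e → coeff (Sser 1 t *L Tser 1 l) -[1+ e ] ≈ cauchy W (delay (λ m → Tc 1 m l)) e
    delayed zero    = sym (cauchy-delay-zero W (λ m → Tc 1 m l))
    delayed (suc e) = trans (cauchy-congˡ (λ m → Tc 1 m l) e (λ n → Sc≈walks-suc n t))
                            (sym (cauchy-delay W (λ m → Tc 1 m l) e))

  coeff-term-<p : ∀ l e → l < p → coeff (term l) -[1+ e ] ≈ crossing (+ 1) (suc e) l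
  coeff-term-<p l e l<p = trans (coeff-·L _ (Sm1 1 (p ∸ l) *L Tm1 1 l) -[1+ e ])
    (*-congˡ (trans (coeff-Sm1*Tm1 (ℕP.m<n⇒0<n∸m l<p) l e) (sym (cauchy-delay _ _ e))))

  coeff-term-p : ∀ e → coeff (term p) -[1+ e ] ≈ a (ℤ.- + p) * firstPassage (ℤ.- + p) (suc e)
  coeff-term-p e rewrite ℕP.n∸n≡0 p′ = trans (coeff-·L _ (1L *L Tser 1 p′) -[1+ e ])
    (*-congˡ (trans (cauchy-identityˡ (λ n → Tc 1 n p′) e) (Tc≈firstPassage e p′)))

  coeff-Fsum : ∀ e → coeff Fsum -[1+ e ] ≈ firstReturn (suc (suc e))
  coeff-Fsum e = begin
    coeff Fsum -[1+ e ]                                         ≈⟨ coeff-Σ term (upTo (suc p)) -[1+ e ] ⟩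
    sumUpTo (suc p) (λ l → coeff (term l) -[1+ e ])             ≈⟨ sumUpTo-suc p _ ⟩
    sumUpTo p (λ l → coeff (term l) -[1+ e ]) + coeff (term p) -[1+ e ]
      ≈⟨ +-cong (sumUpTo-cong p (λ l l<p → coeff-term-<p l e l<p)) (coeff-term-p e) ⟩
    crossings (+ 1) (suc e) + a (ℤ.- + p) * firstPassage (ℤ.- + p) (suc e)
      ≈⟨ +-congʳ (firstPassage-from-above (suc e) ℕP.≤-refl) ⟨
    firstReturn (suc (suc e))                                   ∎

  firstReturn-1 : firstReturn 1 ≈ 0#
  firstReturn-1 = trans (+-congˡ (trans (*-congˡ (reflexive (firstPassage-zero-≢ { -[1+ p′ ]} (λ ())))) (zeroʳ _)))
                        (+-identityʳ 0#)

  Rc-renewal : ∀ n → Rc n 0 ≈ δ n + cauchy (λ k → Rc k 0) firstReturn n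
  Rc-renewal n = begin
    Rc n 0                                                          ≈⟨ Rc≈paths n 0 ⟩
    paths (+ 0) n (+ 0)                                             ≈⟨ paths-firstReturn n (+ 0) ⟩
    firstPassage (+ 0) n + cauchy (λ k → paths (+ 0) k (+ 0)) firstReturn n
      ≈⟨ +-cong (firstPassage-0≈δ n) (cauchy-congˡ firstReturn n (λ k → sym (Rc≈paths k 0))) ⟩
    δ n + cauchy (λ k → Rc k 0) firstReturn n                       ∎

  z-Fsum-coeff : ℤ → ℕ → C
  z-Fsum-coeff s n = coeff zL (s ℤ.- + n) + coeff (-L Fsum) (s ℤ.- + n)

  z-Fsum-coeff≈δ-firstReturn : ∀ n → z-Fsum-coeff (+ 1) n ≈ δ n + - firstReturn n
  z-Fsum-coeff≈δ-firstReturn zero            = +-congˡ (trans (coeff--L Fsum (+ 1)) (-‿cong (coeff-Fsum-nonneg 1)))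
  z-Fsum-coeff≈δ-firstReturn (suc zero)      =
    +-congˡ (trans (coeff--L Fsum (+ 0)) (-‿cong (trans (coeff-Fsum-nonneg 0) (sym firstReturn-1))))
  z-Fsum-coeff≈δ-firstReturn (suc (suc e))   = +-congˡ (trans (coeff--L Fsum -[1+ e ]) (-‿cong (coeff-Fsum e)))

  Rser0-inverse : (Rser 0 *L (zL -L Fsum)) ≈L 1L
  Rser0-inverse = at-shift _ (ℤP.i≥j⇒i⊔j≡i (ℤP.≤-trans Fsum-shift≤0 (ℤ.+≤+ z≤n)))
    where
    R₀ = λ k → Rc k 0
    coefficients : ∀ n → cauchy R₀ (z-Fsum-coeff (+ 1)) n ≈ δ n
    coefficients n = begin
      cauchy R₀ (z-Fsum-coeff (+ 1)) n              ≈⟨ cauchy-congʳ R₀ n z-Fsum-coeff≈δ-firstReturn ⟩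
      cauchy R₀ (λ i → δ i + - firstReturn i) n     ≈⟨ cauchy-distribˡ R₀ δ (λ i → - firstReturn i) n ⟩
      cauchy R₀ δ n + cauchy R₀ (λ i → - firstReturn i) n
        ≈⟨ +-cong (trans (cauchy-identityʳ R₀ n) (Rc-renewal n)) (cauchy-negʳ R₀ firstReturn n) ⟩
      (δ n + cauchy R₀ firstReturn n) + - cauchy R₀ firstReturn n
        ≈⟨ +-assoc _ _ _ ⟩
      δ n + (cauchy R₀ firstReturn n + - cauchy R₀ firstReturn n)
        ≈⟨ +-congˡ (-‿inverseʳ _) ⟩
      δ n + 0#                                      ≈⟨ +-identityʳ _ ⟩
      δ n                                           ∎
    -- The shift of zL -L Fsum is 1 ⊔ shift Fsum, equal to 1 only propositionally.
    at-shift : ∀ s → s ≡ + 1 → lau (-[1+ 0 ] ℤ.+ s) (cauchy R₀ (z-Fsum-coeff s)) ≈L 1L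
    at-shift .(+ 1) P.refl = lau-cong (+ 0) coefficients

corollary3p4 : ∀ {c ℓ} (R : CommutativeRing c ℓ) (p : ℕ) → 1 ≤ p →
    (a : ℤ → CommutativeRing.Carrier R) →
    let open Paths R p a in
    ((Rser 0 *L (zL -L Fsum)) ≈L 1L)
    × (∀ j → 1 ≤ j → j ≤ p → Rser j ≈L (Rser 0 *L Sm1 1 j))
    × (∀ i j → i < j → j ≤ p → Rser j ≈L (Rser i *L Sm1 (suc i) (j ∸ i)))
corollary3p4 R (suc p′) _ a =
  FirstPassage.Rser0-inverse R p′ a ,
  (λ j 1≤j _ → LatticePaths.Rser-factor R (suc p′) a 1≤j) ,
  (λ i j i<j _ → LatticePaths.Rser-factor R (suc p′) a i<j)
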